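{- Let $g: \mathbb{N} \to \mathbb{Z}$ be an arithmetic function with $g(1) = 1$, and let $p$ be a prime. Then the reduction of $A_p^g(X)$ modulo $p$ splits into linear factors in $\mathbb{F}_p[X]$ if and only if $g(p) \equiv 0$ or $1 \pmod p$.
   Context: For an arithmetic function $g:\mathbb{N}\to\mathbb{Z}$ with $g(1)=1$, the polynomials $P_n^g(X) \in \mathbb{Q}[X]$ are defined by $\sum_{n=0}^\infty P_n^g(X) q^n = \exp\big(X \sum_{n=1}^\infty g(n)\frac{q^n}{n}\big)$, and $A_n^g(X) := n!\,P_n^g(X) \in \mathbb{Z}[X]$. -}

module Defs where

open import Data.Nat using (ℕ; zero; suc)
import Data.Nat as ℕ
open import Data.Integer using (ℤ; +_; _+_; _*_; -_; _-_)
open import Data.Integer.Divisibility using (_∣_)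
open import Data.List using (List; []; _∷_)
open import Data.Product using (∃; ∃-syntax)

-- Polynomials in ℤ[X] as coefficient lists, lowest degree first
-- (trailing zeros allowed; all comparisons are coefficientwise).
Poly : Set
Poly = List ℤ

coeff : Poly → ℕ → ℤ
coeff []       _       = + 0
coeff (a ∷ f)  zero    = a
coeff (a ∷ f)  (suc i) = coeff f i

polyAdd : Poly → Poly → Poly
polyAdd []      g       = g
polyAdd f       []      = f
polyAdd (a ∷ f) (b ∷ g) = (a + b) ∷ polyAdd f g

polyScale : ℤ → Poly → Poly
polyScale c []      = []
polyScale c (a ∷ f) = (c * a) ∷ polyScale c f

polyMulX : Poly → Poly
polyMulX f = + 0 ∷ f

polyMul : Poly → Poly → Poly
polyMul []      g = []
polyMul (a ∷ f) g = polyAdd (polyScale a g) (polyMulX (polyMul f g))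

fall : ℕ → ℕ → ℕ
fall n       zero    = 1
fall zero    (suc j) = 0
fall (suc n) (suc j) = suc n ℕ.* fall n j

-- The polynomials A_n^g(X) = n! P_n^g(X).
-- Differentiating  Σ P_n q^n = exp(X Σ g(n) q^n / n)  in q gives
--   n P_n = X Σ_{k=1}^{n} g(k) P_{n-k},   P_0 = 1,
-- hence  A_n = X Σ_{k=1}^{n} g(k) (n-1)!/(n-k)! A_{n-k},  A_0 = 1.
-- tbl g n = [A_n, A_{n-1}, ..., A_0].
private
  step : (ℕ → ℤ) → ℕ → ℕ → List Poly → Poly
  step g n j []       = []
  step g n j (a ∷ as) =
    polyAdd (polyScale (g (suc j) * + fall n j) a) (step g n (suc j) as)

tbl : (ℕ → ℤ) → ℕ → List Poly
tbl g zero    = (+ 1 ∷ []) ∷ []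
tbl g (suc n) = polyMulX (step g n 0 (tbl g n)) ∷ tbl g n

A : (ℕ → ℤ) → ℕ → Poly
A g n with tbl g n
... | []    = []
... | a ∷ _ = a

_≡[_]ₚ_ : Poly → ℕ → Poly → Set
f ≡[ p ]ₚ h = ∀ i → (+ p) ∣ (coeff f i - coeff h i)

prodLin : List ℤ → Poly
prodLin []       = + 1 ∷ []
prodLin (r ∷ rs) = polyMul (- r ∷ + 1 ∷ []) (prodLin rs)

SplitsMod : ℕ → Poly → Set
SplitsMod p f = ∃[ c ] ∃[ rs ] (f ≡[ p ]ₚ polyScale c (prodLin rs))

{-# OPTIONS --safe #-}
-- Put γ i = (i - 1)! g i and γ 0 = 0.  Then Σ A_n qⁿ/n! = exp (X Σ γ i qⁱ/i!), so m! times the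
-- coefficient of Xᵐ in A_n is the n-th term of the m-th power of γ under the binomial
-- convolution ⋆.  For 1 < m < p every term of that power at n = p carries a binomial coefficient
-- divisible by p, hence A_p ≡ Xᵖ + (p - 1)! g(p) X (mod p).  If g(p) ≡ 0 this is Xᵖ, and if
-- g(p) ≡ 1 it agrees with A_p for g = 1, the rising factorial X (X + 1) ⋯ (X + p - 1).
-- Conversely, let c ∏ (X - rᵢ) ≡ A_p.  If every rᵢ ≡ 0, comparing coefficients gives g(p) ≡ 0.
-- Otherwise some root r ≢ 0 exists, and since the rising factorial vanishes at every integer
-- mod p, subtracting the two congruences at r gives (p - 1)! (g(p) - 1) r ≡ 0, so g(p) ≡ 1.
module Submission where

open import Defs
open import Data.Nat using (ℕ)
open import Data.Nat.Primality using (Prime)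
open import Data.Integer using (ℤ; +_; _-_)
open import Data.Integer.Divisibility using (_∣_)
open import Data.Sum using (_⊎_)
open import Relation.Binary.PropositionalEquality using (_≡_)
open import Function.Bundles using (_⇔_)

open import Data.Nat using (zero; suc; _!; _<_; s≤s; z≤n)
import Data.Nat as ℕ
import Data.Nat.Divisibility as ℕ
import Data.Nat.Properties as ℕ
import Data.Nat.Tactic.RingSolver as ℕ-Solver
open import Data.Nat.Primality using (euclidsLemma; ¬prime[1])
open import Data.Integer using (_+_; _*_; -_)
import Data.Integer as ℤ
open import Data.Integer.DivMod using (_%ℕ_; _/ℕ_; n%ℕd<d; a≡a%ℕn+[a/ℕn]*n)
open import Data.Integer.Divisibility.Signed as Signed using (∣ᵤ⇒∣; ∣⇒∣ᵤ)
open import Data.Integer.Properties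
open import Data.Integer.Tactic.RingSolver using (solve-∀)
open import Data.List using (List; []; _∷_; length; replicate; applyDownFrom)
open import Data.List.Properties using (length-replicate)
open import Data.List.Membership.Propositional using (_∈_; find)
open import Data.List.Membership.Propositional.Properties using (∈-applyDownFrom⁺)
open import Data.List.Relation.Unary.All as All using (All)
open import Data.List.Relation.Unary.All.Properties using (replicate⁺; ¬All⇒Any¬)
open import Data.List.Relation.Unary.Any using (here; there)
open import Data.Product using (_,_)
open import Data.Sum using (inj₁; inj₂; [_,_])
import Data.Sum as Sum
open import Function using (_∘_)
open import Function.Bundles using (mk⇔)
open import Level using (0ℓ)
open import Relation.Binary.Bundles using (Setoid)
open import Relation.Binary.Definitions using (tri<; tri≈; tri>)
open import Relation.Binary.PropositionalEquality using (_≢_; refl; sym; trans; cong; cong₂; subst; subst₂; module ≡-Reasoning)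
import Relation.Binary.Reasoning.Setoid as SetoidReasoning
open import Relation.Nullary using (¬_; Dec; yes; no; contradiction)
import Relation.Nullary.Decidable as Dec

coeff-polyAdd : ∀ f h i → coeff (polyAdd f h) i ≡ coeff f i + coeff h i
coeff-polyAdd []      h       i       = sym (+-identityˡ _)
coeff-polyAdd (a ∷ f) []      i       = sym (+-identityʳ _)
coeff-polyAdd (a ∷ f) (b ∷ h) zero    = refl
coeff-polyAdd (a ∷ f) (b ∷ h) (suc i) = coeff-polyAdd f h i

coeff-polyScale : ∀ c f i → coeff (polyScale c f) i ≡ c * coeff f i
coeff-polyScale c []      i       = sym (*-zeroʳ c)
coeff-polyScale c (a ∷ f) zero    = refl
coeff-polyScale c (a ∷ f) (suc i) = coeff-polyScale c f i

coeff-polyMulX-[] : ∀ i → coeff (polyMulX []) i ≡ + 0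
coeff-polyMulX-[] zero    = refl
coeff-polyMulX-[] (suc i) = refl

coeff-polyMul-linear : ∀ r f i →
  coeff (polyMul (- r ∷ + 1 ∷ []) f) i ≡ - r * coeff f i + coeff (polyMulX f) i
coeff-polyMul-linear r f i =
  trans (coeff-polyAdd (polyScale (- r) f) _ i)
        (cong₂ _+_ (coeff-polyScale (- r) f i) (shifted i))
  where
  shifted : ∀ i → coeff (polyMulX (polyMul (+ 1 ∷ []) f)) i ≡ coeff (polyMulX f) i
  shifted zero    = refl
  shifted (suc i) = begin
    coeff (polyAdd (polyScale (+ 1) f) (polyMulX [])) i   ≡⟨ coeff-polyAdd (polyScale (+ 1) f) _ i ⟩
    coeff (polyScale (+ 1) f) i + coeff (polyMulX []) i   ≡⟨ cong₂ _+_ (coeff-polyScale (+ 1) f i) (coeff-polyMulX-[] i) ⟩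
    + 1 * coeff f i + + 0                                 ≡⟨ unit (coeff f i) ⟩
    coeff f i                                             ∎
    where
    open ≡-Reasoning
    unit : ∀ c → + 1 * c + + 0 ≡ c
    unit = solve-∀

monomial : ℕ → Poly
monomial zero    = + 1 ∷ []
monomial (suc n) = + 0 ∷ monomial n

coeff-monomial-≡ : ∀ n → coeff (monomial n) n ≡ + 1
coeff-monomial-≡ zero    = refl
coeff-monomial-≡ (suc n) = coeff-monomial-≡ n

coeff-monomial-≢ : ∀ {i n} → i ≢ n → coeff (monomial n) i ≡ + 0
coeff-monomial-≢ {zero}  {zero}  i≢n = contradiction refl i≢n
coeff-monomial-≢ {zero}  {suc n} i≢n = refl
coeff-monomial-≢ {suc i} {zero}  i≢n = refl
coeff-monomial-≢ {suc i} {suc n} i≢n = coeff-monomial-≢ (i≢n ∘ cong suc)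

eval : Poly → ℤ → ℤ
eval []      x = + 0
eval (a ∷ f) x = a + x * eval f x

eval-polyAdd : ∀ f h x → eval (polyAdd f h) x ≡ eval f x + eval h x
eval-polyAdd []      h       x = sym (+-identityˡ _)
eval-polyAdd (a ∷ f) []      x = sym (+-identityʳ _)
eval-polyAdd (a ∷ f) (b ∷ h) x = begin
  a + b + x * eval (polyAdd f h) x      ≡⟨ cong (λ e → a + b + x * e) (eval-polyAdd f h x) ⟩
  a + b + x * (eval f x + eval h x)     ≡⟨ ring a b x (eval f x) (eval h x) ⟩
  a + x * eval f x + (b + x * eval h x) ∎
  where
  open ≡-Reasoning
  ring : ∀ a b x u v → a + b + x * (u + v) ≡ a + x * u + (b + x * v)
  ring = solve-∀

eval-polyScale : ∀ c f x → eval (polyScale c f) x ≡ c * eval f x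
eval-polyScale c []      x = sym (*-zeroʳ c)
eval-polyScale c (a ∷ f) x = begin
  c * a + x * eval (polyScale c f) x ≡⟨ cong (λ e → c * a + x * e) (eval-polyScale c f x) ⟩
  c * a + x * (c * eval f x)         ≡⟨ ring c a x (eval f x) ⟩
  c * (a + x * eval f x)             ∎
  where
  open ≡-Reasoning
  ring : ∀ c a x u → c * a + x * (c * u) ≡ c * (a + x * u)
  ring = solve-∀

eval-polyMul : ∀ f h x → eval (polyMul f h) x ≡ eval f x * eval h x
eval-polyMul []      h x = refl
eval-polyMul (a ∷ f) h x = begin
  eval (polyAdd (polyScale a h) (polyMulX (polyMul f h))) x
    ≡⟨ eval-polyAdd (polyScale a h) _ x ⟩
  eval (polyScale a h) x + (+ 0 + x * eval (polyMul f h) x)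
    ≡⟨ cong₂ (λ u v → u + (+ 0 + x * v)) (eval-polyScale a h x) (eval-polyMul f h x) ⟩
  a * eval h x + (+ 0 + x * (eval f x * eval h x))
    ≡⟨ ring a x (eval f x) (eval h x) ⟩
  (a + x * eval f x) * eval h x ∎
  where
  open ≡-Reasoning
  ring : ∀ a x u v → a * v + (+ 0 + x * (u * v)) ≡ (a + x * u) * v
  ring = solve-∀

eval-prodLin-∷ : ∀ r rs x → eval (prodLin (r ∷ rs)) x ≡ (x - r) * eval (prodLin rs) x
eval-prodLin-∷ r rs x =
  trans (eval-polyMul (- r ∷ + 1 ∷ []) (prodLin rs) x) (cong (_* eval (prodLin rs) x) (linear r x))
  where
  linear : ∀ r x → - r + x * (+ 1 + x * + 0) ≡ x - r
  linear = solve-∀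

binom : ℕ → ℕ → ℕ
binom zero    j       = 1
binom (suc i) zero    = 1
binom (suc i) (suc j) = binom i (suc j) ℕ.+ binom (suc i) j

binom-! : ∀ i j → binom i j ℕ.* (i ! ℕ.* j !) ≡ (i ℕ.+ j) !
binom-! zero    j       = trans (ℕ.+-identityʳ _) (ℕ.+-identityʳ _)
binom-! (suc i) zero    = trans (ℕ.+-identityʳ _) (trans (ℕ.*-identityʳ _) (cong _! (sym (ℕ.+-identityʳ (suc i)))))
binom-! (suc i) (suc j) = begin
  (x ℕ.+ y) ℕ.* (suc i ! ℕ.* suc j !)
    ≡⟨ distribute x y i j (i !) (j !) ⟩
  suc i ℕ.* (x ℕ.* (i ! ℕ.* suc j !)) ℕ.+ suc j ℕ.* (y ℕ.* (suc i ! ℕ.* j !))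
    ≡⟨ cong₂ (λ u v → suc i ℕ.* u ℕ.+ suc j ℕ.* v) (trans (binom-! i (suc j)) (cong _! (ℕ.+-suc i j))) (binom-! (suc i) j) ⟩
  suc i ℕ.* suc (i ℕ.+ j) ! ℕ.+ suc j ℕ.* suc (i ℕ.+ j) !
    ≡⟨ collect i j (suc (i ℕ.+ j) !) ⟩
  suc (suc (i ℕ.+ j)) !
    ≡⟨ cong (λ k → suc k !) (sym (ℕ.+-suc i j)) ⟩
  (suc i ℕ.+ suc j) ! ∎
  where
  open ≡-Reasoning
  x = binom i (suc j)
  y = binom (suc i) j
  distribute : ∀ x y i j a b → (x ℕ.+ y) ℕ.* ((suc i ℕ.* a) ℕ.* (suc j ℕ.* b))
             ≡ suc i ℕ.* (x ℕ.* (a ℕ.* (suc j ℕ.* b))) ℕ.+ suc j ℕ.* (y ℕ.* ((suc i ℕ.* a) ℕ.* b))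
  distribute = ℕ-Solver.solve-∀
  collect : ∀ i j F → suc i ℕ.* F ℕ.+ suc j ℕ.* F ≡ suc (suc (i ℕ.+ j)) ℕ.* F
  collect = ℕ-Solver.solve-∀

fall-! : ∀ i j → fall (i ℕ.+ j) i ℕ.* j ! ≡ (i ℕ.+ j) !
fall-! zero    j = ℕ.+-identityʳ (j !)
fall-! (suc i) j = trans (ℕ.*-assoc (suc (i ℕ.+ j)) (fall (i ℕ.+ j) i) (j !)) (cong (suc (i ℕ.+ j) ℕ.*_) (fall-! i j))

fall-binom : ∀ i j → fall (i ℕ.+ j) i ≡ binom i j ℕ.* i !
fall-binom i j = ℕ.*-cancelʳ-≡ _ _ (j !) {{j ℕ.!≢0}} (begin
  fall (i ℕ.+ j) i ℕ.* j !      ≡⟨ fall-! i j ⟩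
  (i ℕ.+ j) !                   ≡⟨ binom-! i j ⟨
  binom i j ℕ.* (i ! ℕ.* j !)   ≡⟨ ℕ.*-assoc (binom i j) (i !) (j !) ⟨
  binom i j ℕ.* i ! ℕ.* j !     ∎)
  where open ≡-Reasoning

antidiagSum : (ℕ → ℕ → ℤ) → ℕ → ℤ
antidiagSum F zero    = F 0 0
antidiagSum F (suc n) = F 0 (suc n) + antidiagSum (λ i j → F (suc i) j) n

antidiagSum-cong : ∀ {F G} n → (∀ i j → i ℕ.+ j ≡ n → F i j ≡ G i j) → antidiagSum F n ≡ antidiagSum G n
antidiagSum-cong zero    F≡G = F≡G 0 0 refl
antidiagSum-cong (suc n) F≡G = cong₂ _+_ (F≡G 0 (suc n) refl) (antidiagSum-cong n (λ i j → F≡G (suc i) j ∘ cong suc))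

antidiagSum-sucʳ : ∀ F n → antidiagSum F (suc n) ≡ F (suc n) 0 + antidiagSum (λ i j → F i (suc j)) n
antidiagSum-sucʳ F zero    = +-comm (F 0 1) (F 1 0)
antidiagSum-sucʳ F (suc n) = begin
  F 0 (2 ℕ.+ n) + antidiagSum (λ i j → F (suc i) j) (suc n)
    ≡⟨ cong (_+_ (F 0 (2 ℕ.+ n))) (antidiagSum-sucʳ (λ i j → F (suc i) j) n) ⟩
  F 0 (2 ℕ.+ n) + (F (2 ℕ.+ n) 0 + antidiagSum (λ i j → F (suc i) (suc j)) n)
    ≡⟨ x+[y+z]≡y+[x+z] (F 0 (2 ℕ.+ n)) (F (2 ℕ.+ n) 0) _ ⟩
  F (2 ℕ.+ n) 0 + (F 0 (2 ℕ.+ n) + antidiagSum (λ i j → F (suc i) (suc j)) n) ∎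
  where
  open ≡-Reasoning
  x+[y+z]≡y+[x+z] : ∀ x y z → x + (y + z) ≡ y + (x + z)
  x+[y+z]≡y+[x+z] = solve-∀

antidiagSum-+ : ∀ F G n → antidiagSum (λ i j → F i j + G i j) n ≡ antidiagSum F n + antidiagSum G n
antidiagSum-+ F G zero    = refl
antidiagSum-+ F G (suc n) = begin
  F 0 (suc n) + G 0 (suc n) + antidiagSum (λ i j → F (suc i) j + G (suc i) j) n
    ≡⟨ cong (_+_ (F 0 (suc n) + G 0 (suc n))) (antidiagSum-+ (λ i j → F (suc i) j) (λ i j → G (suc i) j) n) ⟩
  F 0 (suc n) + G 0 (suc n) + (antidiagSum (λ i j → F (suc i) j) n + antidiagSum (λ i j → G (suc i) j) n)
    ≡⟨ +-interchange (F 0 (suc n)) (G 0 (suc n)) _ _ ⟩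
  F 0 (suc n) + antidiagSum (λ i j → F (suc i) j) n + (G 0 (suc n) + antidiagSum (λ i j → G (suc i) j) n) ∎
  where
  open ≡-Reasoning
  +-interchange : ∀ a b c d → a + b + (c + d) ≡ a + c + (b + d)
  +-interchange = solve-∀

antidiagSum-*ˡ : ∀ c F n → antidiagSum (λ i j → c * F i j) n ≡ c * antidiagSum F n
antidiagSum-*ˡ c F zero    = refl
antidiagSum-*ˡ c F (suc n) =
  trans (cong (_+_ (c * F 0 (suc n))) (antidiagSum-*ˡ c (λ i j → F (suc i) j) n)) (sym (*-distribˡ-+ c _ _))

antidiagSum-zero : ∀ F n → (∀ i j → i ℕ.+ j ≡ n → F i j ≡ + 0) → antidiagSum F n ≡ + 0
antidiagSum-zero F n F≡0 = trans (antidiagSum-cong n F≡0) (zeros n)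
  where
  zeros : ∀ n → antidiagSum (λ _ _ → + 0) n ≡ + 0
  zeros zero    = refl
  zeros (suc n) = trans (+-identityˡ _) (zeros n)

antidiagSum-head : ∀ F n → (∀ i j → suc i ℕ.+ j ≡ n → F (suc i) j ≡ + 0) → antidiagSum F n ≡ F 0 n
antidiagSum-head F zero    _    = refl
antidiagSum-head F (suc n) F≡0 =
  trans (cong (_+_ (F 0 (suc n))) (antidiagSum-zero (λ i j → F (suc i) j) n (λ i j → F≡0 i j ∘ cong suc)))
        (+-identityʳ (F 0 (suc n)))

-- On exponential generating functions, ⋆ is the product and ∂ the derivative.
infixl 7 _⋆_
_⋆_ : (ℕ → ℤ) → (ℕ → ℤ) → ℕ → ℤ
(f ⋆ h) = antidiagSum (λ i j → + binom i j * (f i * h j))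

∂ : (ℕ → ℤ) → ℕ → ℤ
∂ f n = f (suc n)

⋆-leibniz : ∀ f h n → (f ⋆ h) (suc n) ≡ (∂ f ⋆ h) n + (f ⋆ ∂ h) n
⋆-leibniz f h zero    = +-comm (T 0 1) (T 1 0)
  where
  T : ℕ → ℕ → ℤ
  T i j = + binom i j * (f i * h j)
⋆-leibniz f h (suc n) = begin
  T 0 (2 ℕ.+ n) + antidiagSum (λ i j → T (suc i) j) (suc n)
    ≡⟨ cong (_+_ (T 0 (2 ℕ.+ n))) (antidiagSum-sucʳ (λ i j → T (suc i) j) n) ⟩
  T 0 (2 ℕ.+ n) + (T (2 ℕ.+ n) 0 + antidiagSum (λ i j → T (suc i) (suc j)) n)
    ≡⟨ cong (λ s → T 0 (2 ℕ.+ n) + (T (2 ℕ.+ n) 0 + s)) (trans (antidiagSum-cong n (λ i j _ → pascal i j)) (antidiagSum-+ X Y n)) ⟩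
  T 0 (2 ℕ.+ n) + (T (2 ℕ.+ n) 0 + (antidiagSum X n + antidiagSum Y n))
    ≡⟨ regroup (T 0 (2 ℕ.+ n)) (T (2 ℕ.+ n) 0) (antidiagSum X n) (antidiagSum Y n) ⟩
  T (2 ℕ.+ n) 0 + antidiagSum X n + (T 0 (2 ℕ.+ n) + antidiagSum Y n)
    ≡⟨ cong (_+ (f ⋆ ∂ h) (suc n)) (antidiagSum-sucʳ (λ i j → + binom i j * (∂ f i * h j)) n) ⟨
  (∂ f ⋆ h) (suc n) + (f ⋆ ∂ h) (suc n) ∎
  where
  open ≡-Reasoning
  T X Y : ℕ → ℕ → ℤ
  T i j = + binom i j * (f i * h j)
  X i j = + binom i (suc j) * (f (suc i) * h (suc j))
  Y i j = + binom (suc i) j * (f (suc i) * h (suc j))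
  pascal : ∀ i j → T (suc i) (suc j) ≡ X i j + Y i j
  pascal i j = trans (cong (_* (f (suc i) * h (suc j))) (pos-+ (binom i (suc j)) (binom (suc i) j)))
                     (*-distribʳ-+ (f (suc i) * h (suc j)) (+ binom i (suc j)) (+ binom (suc i) j))
  regroup : ∀ a b c d → a + (b + (c + d)) ≡ b + c + (a + d)
  regroup = solve-∀

⋆-cong : ∀ {f f′ h h′} n → (∀ k → f k ≡ f′ k) → (∀ k → h k ≡ h′ k) → (f ⋆ h) n ≡ (f′ ⋆ h′) n
⋆-cong n f≡f′ h≡h′ = antidiagSum-cong n (λ i j _ → cong₂ (λ u v → + binom i j * (u * v)) (f≡f′ i) (h≡h′ j))

⋆-distribˡ : ∀ f h r n → (f ⋆ (λ k → h k + r k)) n ≡ (f ⋆ h) n + (f ⋆ r) n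
⋆-distribˡ f h r n = trans (antidiagSum-cong n (λ i j _ → distrib (+ binom i j) (f i) (h j) (r j))) (antidiagSum-+ _ _ n)
  where
  distrib : ∀ c a b d → c * (a * (b + d)) ≡ c * (a * b) + c * (a * d)
  distrib = solve-∀

⋆-distribʳ : ∀ f h r n → ((λ k → f k + h k) ⋆ r) n ≡ (f ⋆ r) n + (h ⋆ r) n
⋆-distribʳ f h r n = trans (antidiagSum-cong n (λ i j _ → distrib (+ binom i j) (f i) (h i) (r j))) (antidiagSum-+ _ _ n)
  where
  distrib : ∀ c a b d → c * ((a + b) * d) ≡ c * (a * d) + c * (b * d)
  distrib = solve-∀

⋆-*ʳ : ∀ c f h n → (f ⋆ (λ k → c * h k)) n ≡ c * (f ⋆ h) n
⋆-*ʳ c f h n = trans (antidiagSum-cong n (λ i j _ → pull-out (+ binom i j) (f i) c (h j))) (antidiagSum-*ˡ c _ n)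
  where
  pull-out : ∀ b a c d → b * (a * (c * d)) ≡ c * (b * (a * d))
  pull-out = solve-∀

⋆-zeroʳ : ∀ f h n → (∀ k → k ℕ.≤ n → h k ≡ + 0) → (f ⋆ h) n ≡ + 0
⋆-zeroʳ f h n h≡0 = antidiagSum-zero _ n λ i j i+j≡n → begin
  + binom i j * (f i * h j) ≡⟨ cong (λ v → + binom i j * (f i * v)) (h≡0 j (subst (j ℕ.≤_) i+j≡n (ℕ.m≤n+m j i))) ⟩
  + binom i j * (f i * + 0) ≡⟨ cong (+ binom i j *_) (*-zeroʳ (f i)) ⟩
  + binom i j * + 0         ≡⟨ *-zeroʳ (+ binom i j) ⟩
  + 0                       ∎
  where open ≡-Reasoning

⋆-head : ∀ f h n → (∀ i j → suc i ℕ.+ j ≡ n → f (suc i) * h j ≡ + 0) → (f ⋆ h) n ≡ f 0 * h n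
⋆-head f h n fh≡0 =
  trans (antidiagSum-head _ n (λ i j e → trans (cong (+ binom (suc i) j *_) (fh≡0 i j e)) (*-zeroʳ (+ binom (suc i) j))))
        (*-identityˡ (f 0 * h n))

⋆-comm : ∀ f h n → (f ⋆ h) n ≡ (h ⋆ f) n
⋆-comm f h zero    = cong (+ 1 *_) (*-comm (f 0) (h 0))
⋆-comm f h (suc n) = begin
  (f ⋆ h) (suc n)               ≡⟨ ⋆-leibniz f h n ⟩
  (∂ f ⋆ h) n + (f ⋆ ∂ h) n     ≡⟨ cong₂ _+_ (⋆-comm (∂ f) h n) (⋆-comm f (∂ h) n) ⟩
  (h ⋆ ∂ f) n + (∂ h ⋆ f) n     ≡⟨ +-comm ((h ⋆ ∂ f) n) ((∂ h ⋆ f) n) ⟩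
  (∂ h ⋆ f) n + (h ⋆ ∂ f) n     ≡⟨ ⋆-leibniz h f n ⟨
  (h ⋆ f) (suc n)               ∎
  where open ≡-Reasoning

⋆-assoc : ∀ f h r n → (f ⋆ (h ⋆ r)) n ≡ ((f ⋆ h) ⋆ r) n
⋆-assoc f h r zero    = reassoc (f 0) (h 0) (r 0)
  where
  reassoc : ∀ a b c → + 1 * (a * (+ 1 * (b * c))) ≡ + 1 * (+ 1 * (a * b) * c)
  reassoc = solve-∀
⋆-assoc f h r (suc n) = begin
  (f ⋆ (h ⋆ r)) (suc n)
    ≡⟨ ⋆-leibniz f (h ⋆ r) n ⟩
  (∂ f ⋆ (h ⋆ r)) n + (f ⋆ ∂ (h ⋆ r)) n
    ≡⟨ cong (_+_ ((∂ f ⋆ (h ⋆ r)) n)) expand-right ⟩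
  (∂ f ⋆ (h ⋆ r)) n + ((f ⋆ (∂ h ⋆ r)) n + (f ⋆ (h ⋆ ∂ r)) n)
    ≡⟨ cong₂ _+_ (⋆-assoc (∂ f) h r n) (cong₂ _+_ (⋆-assoc f (∂ h) r n) (⋆-assoc f h (∂ r) n)) ⟩
  ((∂ f ⋆ h) ⋆ r) n + (((f ⋆ ∂ h) ⋆ r) n + ((f ⋆ h) ⋆ ∂ r) n)
    ≡⟨ +-assoc (((∂ f ⋆ h) ⋆ r) n) (((f ⋆ ∂ h) ⋆ r) n) (((f ⋆ h) ⋆ ∂ r) n) ⟨
  ((∂ f ⋆ h) ⋆ r) n + ((f ⋆ ∂ h) ⋆ r) n + ((f ⋆ h) ⋆ ∂ r) n
    ≡⟨ cong (_+ ((f ⋆ h) ⋆ ∂ r) n) expand-left ⟨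
  (∂ (f ⋆ h) ⋆ r) n + ((f ⋆ h) ⋆ ∂ r) n
    ≡⟨ ⋆-leibniz (f ⋆ h) r n ⟨
  ((f ⋆ h) ⋆ r) (suc n) ∎
  where
  open ≡-Reasoning
  expand-right : (f ⋆ ∂ (h ⋆ r)) n ≡ (f ⋆ (∂ h ⋆ r)) n + (f ⋆ (h ⋆ ∂ r)) n
  expand-right = trans (⋆-cong {f} {f} {∂ (h ⋆ r)} n (λ _ → refl) (⋆-leibniz h r))
                       (⋆-distribˡ f (∂ h ⋆ r) (h ⋆ ∂ r) n)
  expand-left : (∂ (f ⋆ h) ⋆ r) n ≡ ((∂ f ⋆ h) ⋆ r) n + ((f ⋆ ∂ h) ⋆ r) n
  expand-left = trans (⋆-cong {∂ (f ⋆ h)} {λ k → (∂ f ⋆ h) k + (f ⋆ ∂ h) k} {r} {r} n (⋆-leibniz f h) (λ _ → refl))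
                      (⋆-distribʳ (∂ f ⋆ h) (f ⋆ ∂ h) r n)

⋆-exchange : ∀ f h r n → (f ⋆ (h ⋆ r)) n ≡ (h ⋆ (f ⋆ r)) n
⋆-exchange f h r n = begin
  (f ⋆ (h ⋆ r)) n   ≡⟨ ⋆-assoc f h r n ⟩
  ((f ⋆ h) ⋆ r) n   ≡⟨ ⋆-cong {f ⋆ h} {h ⋆ f} {r} {r} n (⋆-comm f h) (λ _ → refl) ⟩
  ((h ⋆ f) ⋆ r) n   ≡⟨ ⋆-assoc h f r n ⟨
  (h ⋆ (f ⋆ r)) n   ∎
  where open ≡-Reasoning

δ : ℕ → ℤ
δ zero    = + 1
δ (suc _) = + 0

⋆-identityʳ : ∀ f n → (f ⋆ δ) n ≡ f n
⋆-identityʳ f zero    = trans (*-identityˡ (f 0 * + 1)) (*-identityʳ (f 0))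
⋆-identityʳ f (suc n) = begin
  (f ⋆ δ) (suc n)             ≡⟨ ⋆-leibniz f δ n ⟩
  (∂ f ⋆ δ) n + (f ⋆ ∂ δ) n   ≡⟨ cong₂ _+_ (⋆-identityʳ (∂ f) n) (⋆-zeroʳ f (∂ δ) n (λ _ _ → refl)) ⟩
  f (suc n) + + 0             ≡⟨ +-identityʳ (f (suc n)) ⟩
  f (suc n)                   ∎
  where open ≡-Reasoning

convPow : (ℕ → ℤ) → ℕ → ℕ → ℤ
convPow f zero    = δ
convPow f (suc m) = f ⋆ convPow f m

∂-convPow : ∀ f m n → ∂ (convPow f (suc m)) n ≡ + suc m * (∂ f ⋆ convPow f m) n
∂-convPow f zero    n = begin
  (f ⋆ δ) (suc n)       ≡⟨ ⋆-identityʳ f (suc n) ⟩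
  ∂ f n                 ≡⟨ ⋆-identityʳ (∂ f) n ⟨
  (∂ f ⋆ δ) n           ≡⟨ *-identityˡ ((∂ f ⋆ δ) n) ⟨
  + 1 * (∂ f ⋆ δ) n     ∎
  where open ≡-Reasoning
∂-convPow f (suc m) n = begin
  (f ⋆ fᵐ⁺¹) (suc n)
    ≡⟨ ⋆-leibniz f fᵐ⁺¹ n ⟩
  (∂ f ⋆ fᵐ⁺¹) n + (f ⋆ ∂ fᵐ⁺¹) n
    ≡⟨ cong (_+_ ((∂ f ⋆ fᵐ⁺¹) n)) (⋆-cong {f} {f} {∂ fᵐ⁺¹} n (λ _ → refl) (∂-convPow f m)) ⟩
  (∂ f ⋆ fᵐ⁺¹) n + (f ⋆ (λ k → + suc m * (∂ f ⋆ fᵐ) k)) n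
    ≡⟨ cong (_+_ ((∂ f ⋆ fᵐ⁺¹) n)) (⋆-*ʳ (+ suc m) f (∂ f ⋆ fᵐ) n) ⟩
  (∂ f ⋆ fᵐ⁺¹) n + + suc m * (f ⋆ (∂ f ⋆ fᵐ)) n
    ≡⟨ cong (λ s → (∂ f ⋆ fᵐ⁺¹) n + + suc m * s) (⋆-exchange f (∂ f) fᵐ n) ⟩
  (∂ f ⋆ fᵐ⁺¹) n + + suc m * (∂ f ⋆ fᵐ⁺¹) n
    ≡⟨ collect ((∂ f ⋆ fᵐ⁺¹) n) (+ suc m) ⟩
  (+ 1 + + suc m) * (∂ f ⋆ fᵐ⁺¹) n
    ≡⟨ cong (_* (∂ f ⋆ fᵐ⁺¹) n) (pos-+ 1 (suc m)) ⟨
  + suc (suc m) * (∂ f ⋆ fᵐ⁺¹) n ∎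
  where
  open ≡-Reasoning
  fᵐ fᵐ⁺¹ : ℕ → ℤ
  fᵐ   = convPow f m
  fᵐ⁺¹ = convPow f (suc m)
  collect : ∀ x c → x + c * x ≡ (+ 1 + c) * x
  collect = solve-∀

coeffA : (ℕ → ℤ) → ℕ → ℕ → ℤ
coeffA g n m = coeff (A g n) m

-- A public copy of the private step function of Defs.
tblStep : (ℕ → ℤ) → ℕ → ℕ → List Poly → Poly
tblStep g n j []       = []
tblStep g n j (a ∷ as) = polyAdd (polyScale (g (suc j) * + fall n j) a) (tblStep g n (suc j) as)

tblStep-unique : ∀ g n {s : ℕ → List Poly → Poly} →
  (∀ j → s j [] ≡ []) →
  (∀ j a as → s j (a ∷ as) ≡ polyAdd (polyScale (g (suc j) * + fall n j) a) (s (suc j) as)) →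
  ∀ j as → s j as ≡ tblStep g n j as
tblStep-unique g n s-[] s-∷ j []       = s-[] j
tblStep-unique g n {s} s-[] s-∷ j (a ∷ as) =
  trans (s-∷ j a as) (cong (polyAdd (polyScale (g (suc j) * + fall n j) a)) (tblStep-unique g n {s} s-[] s-∷ (suc j) as))

-- Abstracting the arguments of the private step turns its unification with s into a pattern problem.
A-suc : ∀ g n → A g (suc n) ≡ polyMulX (tblStep g n 0 (tbl g n))
A-suc g n with tblStep-unique g n (λ _ → refl) (λ _ _ _ → refl) | 0 | tbl g n
... | unique | j | as = cong (+ j ∷_) (unique j as)

coeff-tblStep : ∀ g n j t m →
  coeff (tblStep g n j (tbl g t)) m ≡ antidiagSum (λ i k → g (suc (j ℕ.+ i)) * + fall n (j ℕ.+ i) * coeffA g k m) t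
coeff-tblStep g n j zero    m = begin
  coeff (polyAdd (polyScale (c j) (A g 0)) []) m  ≡⟨ coeff-polyAdd (polyScale (c j) (A g 0)) [] m ⟩
  coeff (polyScale (c j) (A g 0)) m + + 0         ≡⟨ +-identityʳ _ ⟩
  coeff (polyScale (c j) (A g 0)) m               ≡⟨ coeff-polyScale (c j) (A g 0) m ⟩
  c j * coeffA g 0 m                              ≡⟨ cong (λ i → c i * coeffA g 0 m) (ℕ.+-identityʳ j) ⟨
  c (j ℕ.+ 0) * coeffA g 0 m                      ∎
  where
  open ≡-Reasoning
  c : ℕ → ℤ
  c i = g (suc i) * + fall n i
coeff-tblStep g n j (suc t) m = begin
  coeff (polyAdd (polyScale (c j) (A g (suc t))) (tblStep g n (suc j) (tbl g t))) m
    ≡⟨ coeff-polyAdd (polyScale (c j) (A g (suc t))) (tblStep g n (suc j) (tbl g t)) m ⟩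
  coeff (polyScale (c j) (A g (suc t))) m + coeff (tblStep g n (suc j) (tbl g t)) m
    ≡⟨ cong₂ _+_ (coeff-polyScale (c j) (A g (suc t)) m) (coeff-tblStep g n (suc j) t m) ⟩
  c j * coeffA g (suc t) m + antidiagSum (λ i k → c (suc j ℕ.+ i) * coeffA g k m) t
    ≡⟨ cong₂ _+_ (cong (λ i → c i * coeffA g (suc t) m) (ℕ.+-identityʳ j))
                 (antidiagSum-cong t (λ i k _ → cong (λ i → c i * coeffA g k m) (ℕ.+-suc j i))) ⟨
  antidiagSum (λ i k → c (j ℕ.+ i) * coeffA g k m) (suc t) ∎
  where
  open ≡-Reasoning
  c : ℕ → ℤ
  c i = g (suc i) * + fall n i

coeffA-suc-suc : ∀ g n m → coeffA g (suc n) (suc m) ≡ antidiagSum (λ i k → g (suc i) * + fall n i * coeffA g k m) n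
coeffA-suc-suc g n m = trans (cong (λ P → coeff P (suc m)) (A-suc g n)) (coeff-tblStep g n 0 n m)

coeffA-constant : ∀ g m → coeffA g m 0 ≡ δ m
coeffA-constant g zero    = refl
coeffA-constant g (suc m) = refl

γ : (ℕ → ℤ) → ℕ → ℤ
γ g zero    = + 0
γ g (suc i) = + (i !) * g (suc i)

coeffA-⋆ : ∀ g n m → coeffA g (suc n) (suc m) ≡ (∂ (γ g) ⋆ λ k → coeffA g k m) n
coeffA-⋆ g n m = trans (coeffA-suc-suc g n m) (antidiagSum-cong n term)
  where
  term : ∀ i k → i ℕ.+ k ≡ n → g (suc i) * + fall n i * coeffA g k m ≡ + binom i k * (∂ (γ g) i * coeffA g k m)
  term i k refl = begin
    g (suc i) * + fall (i ℕ.+ k) i * coeffA g k m         ≡⟨ cong (λ f → g (suc i) * f * coeffA g k m) (cong +_ (fall-binom i k)) ⟩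
    g (suc i) * + (binom i k ℕ.* i !) * coeffA g k m      ≡⟨ cong (λ f → g (suc i) * f * coeffA g k m) (pos-* (binom i k) (i !)) ⟩
    g (suc i) * (+ binom i k * + (i !)) * coeffA g k m    ≡⟨ reorder (g (suc i)) (+ binom i k) (+ (i !)) (coeffA g k m) ⟩
    + binom i k * (+ (i !) * g (suc i) * coeffA g k m)    ∎
    where
    open ≡-Reasoning
    reorder : ∀ x b f a → x * (b * f) * a ≡ b * (f * x * a)
    reorder = solve-∀

coeffA-convPow : ∀ g m n → + (m !) * coeffA g n m ≡ convPow (γ g) m n
coeffA-convPow g zero    zero    = refl
coeffA-convPow g zero    (suc n) = refl
coeffA-convPow g (suc m) zero    = *-zeroʳ (+ (suc m !))
coeffA-convPow g (suc m) (suc n) = begin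
  + (suc m !) * coeffA g (suc n) (suc m)
    ≡⟨ cong₂ _*_ (pos-* (suc m) (m !)) (coeffA-⋆ g n m) ⟩
  + suc m * + (m !) * (∂ (γ g) ⋆ aₘ) n
    ≡⟨ *-assoc (+ suc m) (+ (m !)) _ ⟩
  + suc m * (+ (m !) * (∂ (γ g) ⋆ aₘ) n)
    ≡⟨ cong (+ suc m *_) (⋆-*ʳ (+ (m !)) (∂ (γ g)) aₘ n) ⟨
  + suc m * (∂ (γ g) ⋆ (λ k → + (m !) * aₘ k)) n
    ≡⟨ cong (+ suc m *_) (⋆-cong {∂ (γ g)} {∂ (γ g)} n (λ _ → refl) (coeffA-convPow g m)) ⟩
  + suc m * (∂ (γ g) ⋆ convPow (γ g) m) n
    ≡⟨ ∂-convPow (γ g) m n ⟨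
  convPow (γ g) (suc m) (suc n) ∎
  where
  open ≡-Reasoning
  aₘ : ℕ → ℤ
  aₘ k = coeffA g k m

coeffA-vanishes : ∀ g {n m} → n < m → coeffA g n m ≡ + 0
coeffA-vanishes g {zero}  {suc m} _ = refl
coeffA-vanishes g {suc n} {suc m} (s≤s n<m) =
  trans (coeffA-⋆ g n m) (⋆-zeroʳ (∂ (γ g)) _ n (λ k k≤n → coeffA-vanishes g (ℕ.≤-<-trans k≤n n<m)))

coeffA-leading : ∀ g → g 1 ≡ + 1 → ∀ n → coeffA g n n ≡ + 1
coeffA-leading g g₁≡1 zero    = refl
coeffA-leading g g₁≡1 (suc n) = begin
  coeffA g (suc n) (suc n)                 ≡⟨ coeffA-⋆ g n n ⟩
  (∂ (γ g) ⋆ (λ k → coeffA g k n)) n       ≡⟨ ⋆-head (∂ (γ g)) _ n lower-terms ⟩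
  + 1 * g 1 * coeffA g n n                 ≡⟨ cong₂ (λ x y → + 1 * x * y) g₁≡1 (coeffA-leading g g₁≡1 n) ⟩
  + 1                                      ∎
  where
  open ≡-Reasoning
  lower-terms : ∀ i j → suc i ℕ.+ j ≡ n → ∂ (γ g) (suc i) * coeffA g j n ≡ + 0
  lower-terms i j refl = trans (cong (∂ (γ g) (suc i) *_) (coeffA-vanishes g (s≤s (ℕ.m≤n+m j i)))) (*-zeroʳ (∂ (γ g) (suc i)))

coeffA-linear : ∀ g n → coeffA g n 1 ≡ γ g n
coeffA-linear g zero    = refl
coeffA-linear g (suc n) = begin
  coeffA g (suc n) 1                   ≡⟨ coeffA-⋆ g n 0 ⟩
  (∂ (γ g) ⋆ (λ k → coeffA g k 0)) n   ≡⟨ ⋆-cong {∂ (γ g)} {∂ (γ g)} n (λ _ → refl) (coeffA-constant g) ⟩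
  (∂ (γ g) ⋆ δ) n                      ≡⟨ ⋆-identityʳ (∂ (γ g)) n ⟩
  γ g (suc n)                          ∎
  where open ≡-Reasoning

𝟙 : ℕ → ℤ
𝟙 _ = + 1

coeffA𝟙-suc-suc : ∀ n m → coeffA 𝟙 (suc n) (suc m) ≡ coeffA 𝟙 n m + + n * coeffA 𝟙 n (suc m)
coeffA𝟙-suc-suc zero    m =
  trans (coeffA-suc-suc 𝟙 0 m) (trans (*-identityˡ (coeffA 𝟙 0 m)) (sym (+-identityʳ (coeffA 𝟙 0 m))))
coeffA𝟙-suc-suc (suc n) m = begin
  coeffA 𝟙 (2 ℕ.+ n) (suc m)
    ≡⟨ coeffA-suc-suc 𝟙 (suc n) m ⟩
  + 1 * + 1 * coeffA 𝟙 (suc n) m + antidiagSum (λ i k → + 1 * + fall (suc n) (suc i) * coeffA 𝟙 k m) n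
    ≡⟨ cong₂ _+_ (*-identityˡ (coeffA 𝟙 (suc n) m)) (antidiagSum-cong n (λ i k _ → factor-out i k)) ⟩
  coeffA 𝟙 (suc n) m + antidiagSum (λ i k → + suc n * (+ 1 * + fall n i * coeffA 𝟙 k m)) n
    ≡⟨ cong (_+_ (coeffA 𝟙 (suc n) m)) (antidiagSum-*ˡ (+ suc n) _ n) ⟩
  coeffA 𝟙 (suc n) m + + suc n * antidiagSum (λ i k → + 1 * + fall n i * coeffA 𝟙 k m) n
    ≡⟨ cong (λ s → coeffA 𝟙 (suc n) m + + suc n * s) (coeffA-suc-suc 𝟙 n m) ⟨
  coeffA 𝟙 (suc n) m + + suc n * coeffA 𝟙 (suc n) (suc m) ∎
  where
  open ≡-Reasoning
  factor-out : ∀ i k → + 1 * + fall (suc n) (suc i) * coeffA 𝟙 k m ≡ + suc n * (+ 1 * + fall n i * coeffA 𝟙 k m)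
  factor-out i k = trans (cong (λ f → + 1 * f * coeffA 𝟙 k m) (pos-* (suc n) (fall n i)))
                         (reorder (+ suc n) (+ fall n i) (coeffA 𝟙 k m))
    where
    reorder : ∀ s f a → + 1 * (s * f) * a ≡ s * (+ 1 * f * a)
    reorder = solve-∀

risingRoots : ℕ → List ℤ
risingRoots = applyDownFrom (λ k → - + k)

coeff-rising : ∀ n m → coeff (prodLin (risingRoots n)) m ≡ coeffA 𝟙 n m
coeff-rising zero    m       = refl
coeff-rising (suc n) zero    = begin
  coeff (prodLin (risingRoots (suc n))) 0           ≡⟨ coeff-polyMul-linear (- + n) (prodLin (risingRoots n)) 0 ⟩
  - - + n * coeff (prodLin (risingRoots n)) 0 + + 0  ≡⟨ +-identityʳ _ ⟩
  - - + n * coeff (prodLin (risingRoots n)) 0        ≡⟨ cong₂ _*_ (neg-involutive (+ n)) (trans (coeff-rising n 0) (coeffA-constant 𝟙 n)) ⟩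
  + n * δ n                                           ≡⟨ n*δn≡0 n ⟩
  + 0                                                 ∎
  where
  open ≡-Reasoning
  n*δn≡0 : ∀ n → + n * δ n ≡ + 0
  n*δn≡0 zero    = refl
  n*δn≡0 (suc n) = *-zeroʳ (+ suc n)
coeff-rising (suc n) (suc m) = begin
  coeff (prodLin (risingRoots (suc n))) (suc m)
    ≡⟨ coeff-polyMul-linear (- + n) (prodLin (risingRoots n)) (suc m) ⟩
  - - + n * coeff (prodLin (risingRoots n)) (suc m) + coeff (prodLin (risingRoots n)) m
    ≡⟨ cong₂ _+_ (cong₂ _*_ (neg-involutive (+ n)) (coeff-rising n (suc m))) (coeff-rising n m) ⟩
  + n * coeffA 𝟙 n (suc m) + coeffA 𝟙 n m
    ≡⟨ +-comm (+ n * coeffA 𝟙 n (suc m)) (coeffA 𝟙 n m) ⟩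
  coeffA 𝟙 n m + + n * coeffA 𝟙 n (suc m)
    ≡⟨ coeffA𝟙-suc-suc n m ⟨
  coeffA 𝟙 (suc n) (suc m) ∎
  where open ≡-Reasoning

module Modulo (p : ℕ) where

  -- A record rather than a definition, so that x and y can be inferred from a proof of x ≈ y.
  infix 4 _≈_
  record _≈_ (x y : ℤ) : Set where
    constructor mod-p
    field p∣x-y : + p Signed.∣ x - y
  open _≈_

  ≈-reflexive : ∀ {x y} → x ≡ y → x ≈ y
  ≈-reflexive {x} refl = mod-p (subst (+ p Signed.∣_) (sym (+-inverseʳ x)) (∣ᵤ⇒∣ (p ℕ.∣0)))

  ≈-refl : ∀ {x} → x ≈ x
  ≈-refl = ≈-reflexive refl

  ≈-sym : ∀ {x y} → x ≈ y → y ≈ x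
  ≈-sym {x} {y} (mod-p d) = mod-p (subst (+ p Signed.∣_) (ring x y) (Signed.∣m⇒∣-m d))
    where
    ring : ∀ x y → - (x - y) ≡ y - x
    ring = solve-∀

  ≈-trans : ∀ {x y z} → x ≈ y → y ≈ z → x ≈ z
  ≈-trans {x} {y} {z} (mod-p d) (mod-p e) = mod-p (subst (+ p Signed.∣_) (ring x y z) (Signed.∣m∣n⇒∣m+n d e))
    where
    ring : ∀ x y z → x - y + (y - z) ≡ x - z
    ring = solve-∀

  ≈-setoid : Setoid 0ℓ 0ℓ
  ≈-setoid = record
    { Carrier       = ℤ
    ; _≈_           = _≈_
    ; isEquivalence = record { refl = ≈-refl ; sym = ≈-sym ; trans = ≈-trans }
    }

  module ≈-Reasoning = SetoidReasoning ≈-setoid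

  +-cong-≈ : ∀ {x y u v} → x ≈ y → u ≈ v → x + u ≈ y + v
  +-cong-≈ {x} {y} {u} {v} (mod-p d) (mod-p e) = mod-p (subst (+ p Signed.∣_) (ring x y u v) (Signed.∣m∣n⇒∣m+n d e))
    where
    ring : ∀ x y u v → x - y + (u - v) ≡ x + u - (y + v)
    ring = solve-∀

  *-congˡ-≈ : ∀ c {x y} → x ≈ y → c * x ≈ c * y
  *-congˡ-≈ c {x} {y} (mod-p d) = mod-p (subst (+ p Signed.∣_) (ring c x y) (Signed.∣n⇒∣m*n c d))
    where
    ring : ∀ c x y → c * (x - y) ≡ c * x - c * y
    ring = solve-∀

  *-congʳ-≈ : ∀ c {x y} → x ≈ y → x * c ≈ y * c
  *-congʳ-≈ c {x} {y} x≈y = subst₂ _≈_ (*-comm c x) (*-comm c y) (*-congˡ-≈ c x≈y)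

  -‿cong-≈ : ∀ {x y} → x ≈ y → - x ≈ - y
  -‿cong-≈ {x} {y} (mod-p d) = mod-p (subst (+ p Signed.∣_) (ring x y) (Signed.∣m⇒∣-m d))
    where
    ring : ∀ x y → - (x - y) ≡ - x - - y
    ring = solve-∀

  x≈y⇒x-y≈0 : ∀ {x y} → x ≈ y → x - y ≈ + 0
  x≈y⇒x-y≈0 {x} {y} (mod-p d) = mod-p (subst (+ p Signed.∣_) (sym (+-identityʳ (x - y))) d)

  x-y≈0⇒x≈y : ∀ {x y} → x - y ≈ + 0 → x ≈ y
  x-y≈0⇒x≈y {x} {y} (mod-p d) = mod-p (subst (+ p Signed.∣_) (+-identityʳ (x - y)) d)

  ≈⇒∣ : ∀ {x y} → x ≈ y → + p ∣ x - y
  ≈⇒∣ = ∣⇒∣ᵤ ∘ p∣x-y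

  ∣⇒≈ : ∀ {x y} → + p ∣ x - y → x ≈ y
  ∣⇒≈ = mod-p ∘ ∣ᵤ⇒∣

  ≈0⇒∣ : ∀ {x} → x ≈ + 0 → + p ∣ x
  ≈0⇒∣ {x} = subst (+ p ∣_) (+-identityʳ x) ∘ ≈⇒∣

  ∣⇒≈0 : ∀ {x} → + p ∣ x → x ≈ + 0
  ∣⇒≈0 {x} = ∣⇒≈ ∘ subst (+ p ∣_) (sym (+-identityʳ x))

  ≈0? : ∀ x → Dec (x ≈ + 0)
  ≈0? x = Dec.map′ ∣⇒≈0 ≈0⇒∣ (p ℕ.∣? ℤ.∣ x ∣)

  ≈-%ℕ : .{{_ : ℕ.NonZero p}} → ∀ x → x ≈ + (x %ℕ p)
  ≈-%ℕ x = mod-p (Signed.divides (x /ℕ p) (begin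
    x - + (x %ℕ p)                           ≡⟨ cong (_- + (x %ℕ p)) (a≡a%ℕn+[a/ℕn]*n x p) ⟩
    + (x %ℕ p) + x /ℕ p * + p - + (x %ℕ p)   ≡⟨ cancel (+ (x %ℕ p)) (x /ℕ p * + p) ⟩
    x /ℕ p * + p                             ∎))
    where
    open ≡-Reasoning
    cancel : ∀ r s → r + s - r ≡ s
    cancel = solve-∀

  antidiagSum-≈0 : ∀ F n → (∀ i j → i ℕ.+ j ≡ n → F i j ≈ + 0) → antidiagSum F n ≈ + 0
  antidiagSum-≈0 F zero    F≈0 = F≈0 0 0 refl
  antidiagSum-≈0 F (suc n) F≈0 =
    +-cong-≈ (F≈0 0 (suc n) refl) (antidiagSum-≈0 (λ i j → F (suc i) j) n (λ i j → F≈0 (suc i) j ∘ cong suc))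

  infix 4 _≈ₚ_
  _≈ₚ_ : Poly → Poly → Set
  f ≈ₚ h = ∀ i → coeff f i ≈ coeff h i

  ≡ₚ⇒≈ₚ : ∀ f h → f ≡[ p ]ₚ h → f ≈ₚ h
  ≡ₚ⇒≈ₚ f h f≡h = ∣⇒≈ ∘ f≡h

  ≈ₚ⇒≡ₚ : ∀ f h → f ≈ₚ h → f ≡[ p ]ₚ h
  ≈ₚ⇒≡ₚ f h f≈h = ≈⇒∣ ∘ f≈h

  polyScale-cong : ∀ c f h → f ≈ₚ h → polyScale c f ≈ₚ polyScale c h
  polyScale-cong c f h f≈h i = begin
    coeff (polyScale c f) i   ≡⟨ coeff-polyScale c f i ⟩
    c * coeff f i             ≈⟨ *-congˡ-≈ c (f≈h i) ⟩
    c * coeff h i             ≡⟨ coeff-polyScale c h i ⟨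
    coeff (polyScale c h) i   ∎
    where open ≈-Reasoning

  private
    horner-cong : ∀ {a b u v} x → a ≈ b → u ≈ v → a + x * u ≈ b + x * v
    horner-cong x a≈b u≈v = +-cong-≈ a≈b (*-congˡ-≈ x u≈v)

    horner-[] : ∀ x → + 0 ≡ + 0 + x * + 0
    horner-[] = solve-∀

  eval-cong : ∀ f h → f ≈ₚ h → ∀ x → eval f x ≈ eval h x
  eval-cong []      []      f≈h x = ≈-refl
  eval-cong []      (b ∷ h) f≈h x = ≈-trans (≈-reflexive (horner-[] x)) (horner-cong x (f≈h 0) (eval-cong [] h (f≈h ∘ suc) x))
  eval-cong (a ∷ f) []      f≈h x = ≈-trans (horner-cong x (f≈h 0) (eval-cong f [] (f≈h ∘ suc) x)) (≈-reflexive (sym (horner-[] x)))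
  eval-cong (a ∷ f) (b ∷ h) f≈h x = horner-cong x (f≈h 0) (eval-cong f h (f≈h ∘ suc) x)

  prodLin-roots≈0 : ∀ rs → All (_≈ + 0) rs → prodLin rs ≈ₚ monomial (length rs)
  prodLin-roots≈0 []       All.[]             i = ≈-refl
  prodLin-roots≈0 (r ∷ rs) (r≈0 All.∷ rs≈0) i = begin
    coeff (prodLin (r ∷ rs)) i
      ≡⟨ coeff-polyMul-linear r (prodLin rs) i ⟩
    - r * coeff (prodLin rs) i + coeff (polyMulX (prodLin rs)) i
      ≈⟨ +-cong-≈ (*-congʳ-≈ (coeff (prodLin rs) i) (-‿cong-≈ r≈0)) (shifted i) ⟩
    + 0 + coeff (monomial (suc (length rs))) i
      ≡⟨ +-identityˡ _ ⟩
    coeff (monomial (suc (length rs))) i ∎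
    where
    open ≈-Reasoning
    shifted : polyMulX (prodLin rs) ≈ₚ polyMulX (monomial (length rs))
    shifted zero    = ≈-refl
    shifted (suc i) = prodLin-roots≈0 rs rs≈0 i

  eval-prodLin-root : ∀ {r rs x} → r ∈ rs → x ≈ r → eval (prodLin rs) x ≈ + 0
  eval-prodLin-root {r} {r ∷ rs} {x} (here refl) x≈r = begin
    eval (prodLin (r ∷ rs)) x      ≡⟨ eval-prodLin-∷ r rs x ⟩
    (x - r) * eval (prodLin rs) x  ≈⟨ *-congʳ-≈ (eval (prodLin rs) x) (x≈y⇒x-y≈0 x≈r) ⟩
    + 0                            ∎
    where open ≈-Reasoning
  eval-prodLin-root {r} {r′ ∷ rs} {x} (there r∈rs) x≈r = begin
    eval (prodLin (r′ ∷ rs)) x      ≡⟨ eval-prodLin-∷ r′ rs x ⟩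
    (x - r′) * eval (prodLin rs) x  ≈⟨ *-congˡ-≈ (x - r′) (eval-prodLin-root r∈rs x≈r) ⟩
    (x - r′) * + 0                  ≡⟨ *-zeroʳ (x - r′) ⟩
    + 0                             ∎
    where open ≈-Reasoning

  module _ (prime : Prime p) where

    *≈0⇒≈0⊎≈0 : ∀ {x y} → x * y ≈ + 0 → x ≈ + 0 ⊎ y ≈ + 0
    *≈0⇒≈0⊎≈0 {x} {y} xy≈0 with euclidsLemma ℤ.∣ x ∣ ℤ.∣ y ∣ prime (subst (p ℕ.∣_) (abs-* x y) (≈0⇒∣ xy≈0))
    ... | inj₁ p∣x = inj₁ (∣⇒≈0 p∣x)
    ... | inj₂ p∣y = inj₂ (∣⇒≈0 p∣y)

    p∤! : ∀ {m} → m < p → ¬ p ℕ.∣ m !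
    p∤! {zero}  m<p p∣1 = ¬prime[1] (subst Prime (ℕ.∣1⇒≡1 p∣1) prime)
    p∤! {suc m} m<p p∣m! with euclidsLemma (suc m) (m !) prime p∣m!
    ... | inj₁ p∣m+1 = ℕ.<⇒≱ m<p (ℕ.∣⇒≤ p∣m+1)
    ... | inj₂ p∣m!  = p∤! (ℕ.<-trans (ℕ.n<1+n m) m<p) p∣m!

    !*≈0⇒≈0 : ∀ {m x} → m < p → + (m !) * x ≈ + 0 → x ≈ + 0
    !*≈0⇒≈0 {m} {x} m<p m!x≈0 with *≈0⇒≈0⊎≈0 {+ (m !)} {x} m!x≈0
    ... | inj₁ m!≈0 = contradiction (≈0⇒∣ m!≈0) (p∤! m<p)
    ... | inj₂ x≈0  = x≈0

    p∣binom : ∀ i j → suc i ℕ.+ suc j ≡ p → p ℕ.∣ binom (suc i) (suc j)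
    p∣binom i j i+j≡p with euclidsLemma (binom (suc i) (suc j)) (suc i ! ℕ.* suc j !) prime p∣binom*i!j!
      where
      p∣binom*i!j! : p ℕ.∣ binom (suc i) (suc j) ℕ.* (suc i ! ℕ.* suc j !)
      p∣binom*i!j! = subst₂ ℕ._∣_ i+j≡p (sym (binom-! (suc i) (suc j))) (ℕ.m∣m*n ((i ℕ.+ suc j) !))
    ... | inj₁ p∣binom = p∣binom
    ... | inj₂ p∣i!j! with euclidsLemma (suc i !) (suc j !) prime p∣i!j!
    ...   | inj₁ p∣i! = contradiction p∣i! (p∤! (subst (suc i <_) i+j≡p (ℕ.m<m+n (suc i) (s≤s z≤n))))
    ...   | inj₂ p∣j! = contradiction p∣j! (p∤! (subst (suc j <_) i+j≡p (ℕ.m<n+m (suc j) (s≤s z≤n))))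

    ⋆-at-p≈0 : ∀ f h → f 0 ≡ + 0 → h 0 ≡ + 0 → (f ⋆ h) p ≈ + 0
    ⋆-at-p≈0 f h f₀≡0 h₀≡0 = antidiagSum-≈0 _ p term
      where
      term : ∀ i j → i ℕ.+ j ≡ p → + binom i j * (f i * h j) ≈ + 0
      term zero    j       _     = ≈-reflexive (cong (λ y → + 1 * (y * h j)) f₀≡0)
      term (suc i) zero    _     = ≈-reflexive (trans (cong (λ y → + 1 * (f (suc i) * y)) h₀≡0) (cong (+ 1 *_) (*-zeroʳ (f (suc i)))))
      term (suc i) (suc j) i+j≡p = *-congʳ-≈ (f (suc i) * h (suc j)) (∣⇒≈0 {+ binom (suc i) (suc j)} (p∣binom i j i+j≡p))

    coeffA-middle≈0 : ∀ g {m} → 1 < m → m < p → coeffA g p m ≈ + 0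
    coeffA-middle≈0 g {suc zero}    (s≤s ()) _
    coeffA-middle≈0 g {suc (suc m)} _        m<p = !*≈0⇒≈0 m<p (begin
      + (suc (suc m) !) * coeffA g p (suc (suc m))   ≡⟨ coeffA-convPow g (suc (suc m)) p ⟩
      (γ g ⋆ convPow (γ g) (suc m)) p               ≈⟨ ⋆-at-p≈0 (γ g) (convPow (γ g) (suc m)) refl refl ⟩
      + 0                                            ∎)
      where open ≈-Reasoning

module Splitting (q : ℕ) (prime : Prime (2 ℕ.+ q)) where

  p : ℕ
  p = 2 ℕ.+ q

  open Modulo p

  Xᵖ+_X : ℤ → Poly
  Xᵖ+ c X = + 0 ∷ c ∷ monomial q

  A≈Xᵖ+γX : ∀ g → g 1 ≡ + 1 → A g p ≈ₚ Xᵖ+ γ g p X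
  A≈Xᵖ+γX g g₁≡1 zero          = ≈-refl
  A≈Xᵖ+γX g g₁≡1 (suc zero)    = ≈-reflexive (coeffA-linear g p)
  A≈Xᵖ+γX g g₁≡1 (suc (suc i)) with ℕ.<-cmp i q
  ... | tri< i<q _ _ = ≈-trans (coeffA-middle≈0 prime g (s≤s (s≤s z≤n)) (s≤s (s≤s i<q)))
                               (≈-reflexive (sym (coeff-monomial-≢ (ℕ.<⇒≢ i<q))))
  ... | tri≈ _ refl _ = ≈-reflexive (trans (coeffA-leading g g₁≡1 p) (sym (coeff-monomial-≡ q)))
  ... | tri> _ _ q<i = ≈-reflexive (trans (coeffA-vanishes g (s≤s (s≤s q<i))) (sym (coeff-monomial-≢ (ℕ.>⇒≢ q<i))))

  Xᵖ+X-cong : ∀ {c c′} → c ≈ c′ → Xᵖ+ c X ≈ₚ Xᵖ+ c′ X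
  Xᵖ+X-cong c≈c′ zero          = ≈-refl
  Xᵖ+X-cong c≈c′ (suc zero)    = c≈c′
  Xᵖ+X-cong c≈c′ (suc (suc i)) = ≈-refl

  eval-Xᵖ+X-difference : ∀ c c′ x → eval (Xᵖ+ c X) x - eval (Xᵖ+ c′ X) x ≡ (c - c′) * x
  eval-Xᵖ+X-difference c c′ x = ring c c′ x (eval (monomial q) x)
    where
    ring : ∀ c c′ x u → + 0 + x * (c + x * u) - (+ 0 + x * (c′ + x * u)) ≡ (c - c′) * x
    ring = solve-∀

  eval-A𝟙≈0 : ∀ x → eval (A 𝟙 p) x ≈ + 0
  eval-A𝟙≈0 x = ≈-trans (eval-cong (A 𝟙 p) (prodLin (risingRoots p)) A𝟙≈rising x)
                        (eval-prodLin-root (∈-applyDownFrom⁺ (λ k → - + k) (n%ℕd<d (- x) p)) x≈-k)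
    where
    A𝟙≈rising : A 𝟙 p ≈ₚ prodLin (risingRoots p)
    A𝟙≈rising i = ≈-reflexive (sym (coeff-rising p i))
    x≈-k : x ≈ - + ((- x) %ℕ p)
    x≈-k = subst (_≈ - + ((- x) %ℕ p)) (neg-involutive x) (-‿cong-≈ (≈-%ℕ (- x)))

  splits-if : ∀ g → g 1 ≡ + 1 → ∀ rs → Xᵖ+ γ g p X ≈ₚ prodLin rs → SplitsMod p (A g p)
  splits-if g g₁≡1 rs X≈rs = + 1 , rs , ≈ₚ⇒≡ₚ (A g p) (polyScale (+ 1) (prodLin rs)) λ i → begin
    coeff (A g p) i                          ≈⟨ A≈Xᵖ+γX g g₁≡1 i ⟩
    coeff (Xᵖ+ γ g p X) i                    ≈⟨ X≈rs i ⟩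
    coeff (prodLin rs) i                     ≡⟨ *-identityˡ (coeff (prodLin rs) i) ⟨
    + 1 * coeff (prodLin rs) i               ≡⟨ coeff-polyScale (+ 1) (prodLin rs) i ⟨
    coeff (polyScale (+ 1) (prodLin rs)) i   ∎
    where open ≈-Reasoning

  splits-if-≈0 : ∀ g → g 1 ≡ + 1 → g p ≈ + 0 → SplitsMod p (A g p)
  splits-if-≈0 g g₁≡1 gₚ≈0 = splits-if g g₁≡1 zeros λ i → begin
    coeff (Xᵖ+ γ g p X) i                       ≈⟨ Xᵖ+X-cong γₚ≈0 i ⟩
    coeff (monomial p) i                        ≡⟨ cong (λ n → coeff (monomial n) i) (length-replicate p) ⟨
    coeff (monomial (length zeros)) i           ≈⟨ prodLin-roots≈0 zeros (replicate⁺ p ≈-refl) i ⟨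
    coeff (prodLin zeros) i                     ∎
    where
    open ≈-Reasoning
    zeros : List ℤ
    zeros = replicate p (+ 0)
    γₚ≈0 : γ g p ≈ + 0
    γₚ≈0 = ≈-trans (*-congˡ-≈ (+ (suc q !)) gₚ≈0) (≈-reflexive (*-zeroʳ (+ (suc q !))))

  splits-if-≈1 : ∀ g → g 1 ≡ + 1 → g p ≈ + 1 → SplitsMod p (A g p)
  splits-if-≈1 g g₁≡1 gₚ≈1 = splits-if g g₁≡1 (risingRoots p) λ i → begin
    coeff (Xᵖ+ γ g p X) i               ≈⟨ Xᵖ+X-cong (*-congˡ-≈ (+ (suc q !)) gₚ≈1) i ⟩
    coeff (Xᵖ+ γ 𝟙 p X) i               ≈⟨ A≈Xᵖ+γX 𝟙 refl i ⟨
    coeff (A 𝟙 p) i                     ≡⟨ coeff-rising p i ⟨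
    coeff (prodLin (risingRoots p)) i   ∎
    where open ≈-Reasoning

  scaled-monomial⇒≈0 : ∀ g → g 1 ≡ + 1 → ∀ c n → A g p ≈ₚ polyScale c (monomial n) → g p ≈ + 0
  scaled-monomial⇒≈0 g g₁≡1 c n A≈cXⁿ with n ℕ.≟ p
  ... | yes refl = !*≈0⇒≈0 prime (ℕ.n<1+n (suc q)) (begin
    γ g p                                  ≡⟨ coeffA-linear g p ⟨
    coeff (A g p) 1                        ≈⟨ A≈cXⁿ 1 ⟩
    coeff (polyScale c (monomial p)) 1     ≡⟨ coeff-polyScale c (monomial p) 1 ⟩
    c * + 0                                ≡⟨ *-zeroʳ c ⟩
    + 0                                    ∎)
    where open ≈-Reasoning
  ... | no n≢p = contradiction (≈0⇒∣ 1≈0) (p∤! prime (s≤s z≤n))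
    where
    open ≈-Reasoning
    1≈0 : + 1 ≈ + 0
    1≈0 = begin
      + 1                                  ≡⟨ coeffA-leading g g₁≡1 p ⟨
      coeff (A g p) p                      ≈⟨ A≈cXⁿ p ⟩
      coeff (polyScale c (monomial n)) p   ≡⟨ coeff-polyScale c (monomial n) p ⟩
      c * coeff (monomial n) p             ≡⟨ cong (c *_) (coeff-monomial-≢ (n≢p ∘ sym)) ⟩
      c * + 0                              ≡⟨ *-zeroʳ c ⟩
      + 0                                  ∎

  unit-root⇒≈1 : ∀ g → g 1 ≡ + 1 → ∀ r → ¬ r ≈ + 0 → eval (A g p) r ≈ + 0 → g p ≈ + 1
  unit-root⇒≈1 g g₁≡1 r r≉0 A[r]≈0 with *≈0⇒≈0⊎≈0 prime difference≈0
    where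
    X[r]≈0 : eval (Xᵖ+ γ g p X) r ≈ + 0
    X[r]≈0 = ≈-trans (≈-sym (eval-cong (A g p) (Xᵖ+ γ g p X) (A≈Xᵖ+γX g g₁≡1) r)) A[r]≈0
    X₁[r]≈0 : eval (Xᵖ+ γ 𝟙 p X) r ≈ + 0
    X₁[r]≈0 = ≈-trans (≈-sym (eval-cong (A 𝟙 p) (Xᵖ+ γ 𝟙 p X) (A≈Xᵖ+γX 𝟙 refl) r)) (eval-A𝟙≈0 r)
    difference≈0 : (γ g p - γ 𝟙 p) * r ≈ + 0
    difference≈0 = subst (_≈ + 0) (eval-Xᵖ+X-difference (γ g p) (γ 𝟙 p) r) (x≈y⇒x-y≈0 (≈-trans X[r]≈0 (≈-sym X₁[r]≈0)))
  ... | inj₂ r≈0 = contradiction r≈0 r≉0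
  ... | inj₁ γ-γ₁≈0 = x-y≈0⇒x≈y (!*≈0⇒≈0 prime (ℕ.n<1+n (suc q)) (subst (_≈ + 0) (factor (+ (suc q !)) (g p)) γ-γ₁≈0))
    where
    factor : ∀ f x → f * x - f * + 1 ≡ f * (x - + 1)
    factor = solve-∀

  splits⇒ : ∀ g → g 1 ≡ + 1 → SplitsMod p (A g p) → g p ≈ + 0 ⊎ g p ≈ + 1
  splits⇒ g g₁≡1 (c , rs , A≡c∏) = by-roots (All.all? ≈0? rs)
    where
    A≈c∏ : A g p ≈ₚ polyScale c (prodLin rs)
    A≈c∏ = ≡ₚ⇒≈ₚ (A g p) (polyScale c (prodLin rs)) A≡c∏

    by-roots : Dec (All (_≈ + 0) rs) → g p ≈ + 0 ⊎ g p ≈ + 1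
    by-roots (yes rs≈0) = inj₁ (scaled-monomial⇒≈0 g g₁≡1 c (length rs) λ i →
      ≈-trans (A≈c∏ i) (polyScale-cong c (prodLin rs) (monomial (length rs)) (prodLin-roots≈0 rs rs≈0) i))
    by-roots (no ¬rs≈0) with find (¬All⇒Any¬ ≈0? rs ¬rs≈0)
    ... | r , r∈rs , r≉0 = inj₂ (unit-root⇒≈1 g g₁≡1 r r≉0 (begin
      eval (A g p) r                      ≈⟨ eval-cong (A g p) (polyScale c (prodLin rs)) A≈c∏ r ⟩
      eval (polyScale c (prodLin rs)) r   ≡⟨ eval-polyScale c (prodLin rs) r ⟩
      c * eval (prodLin rs) r             ≈⟨ *-congˡ-≈ c (eval-prodLin-root r∈rs ≈-refl) ⟩
      c * + 0                             ≡⟨ *-zeroʳ c ⟩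
      + 0                                 ∎))
      where open ≈-Reasoning

  splits⇔ : ∀ g → g 1 ≡ + 1 → SplitsMod p (A g p) ⇔ ((+ p) ∣ g p ⊎ (+ p) ∣ (g p - + 1))
  splits⇔ g g₁≡1 = mk⇔ (Sum.map ≈0⇒∣ ≈⇒∣ ∘ splits⇒ g g₁≡1)
                       [ splits-if-≈0 g g₁≡1 ∘ ∣⇒≈0 , splits-if-≈1 g g₁≡1 ∘ ∣⇒≈ ]

corollary1 : (g : ℕ → ℤ) → g 1 ≡ + 1 → (p : ℕ) → Prime p →
    SplitsMod p (A g p) ⇔ ((+ p) ∣ g p ⊎ (+ p) ∣ (g p - + 1))
corollary1 _ _     0             ()
corollary1 _ _     1             ()
corollary1 g g₁≡1 (suc (suc q)) p-prime = Splitting.splits⇔ q p-prime g g₁≡1
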